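{- A bipartite graph is monotone if and only if it is isomorphic to a graph $G$ such that $A(G)$ has none of the following as an induced $2\times 2$ submatrix: $\Gamma$ (Gamma): $\begin{bmatrix} 1 & 1\\ 1 & 0 \end{bmatrix}$, backwards L: $\begin{bmatrix} 0 & 1\\ 1 & 1 \end{bmatrix}$, slash: $\begin{bmatrix} 0 & 1\\ 1 & 0 \end{bmatrix}$.
   Context: A bipartite graph $G=([m]\cup[n]',E)$ has vertex classes $[m]=\{1,\dots,m\}$ and $[n]'=\{1',\dots,n'\}$, both with their usual linear order, and is assumed to have no isolated vertices. Its biadjacency matrix $A(G)$ is the $m\times n$ 0-1 matrix with rows indexed by $[m]$ and columns by $[n]'$ (in order), with $A(i,j')=1$ iff $(i,j')\in E$. Two bipartite graphs on $[m]\cup[n]'$ are isomorphic if one is obtained from the other by permuting $[m]$ and permuting $[n]'$ (i.e. permuting rows and columns of the biadjacency matrix). An induced $2\times2$ submatrix is the submatrix on rows $i<j$ and columns $k'<\ell'$, kept in this order. $\mathcal{N}(v)$ denotes the neighbourhood of $v$. A bipartite graph is convex if it is isomorphic to a graph $G=([m]\cup[n]',E)$ with $\mathcal{N}(i)$ an interval $[\alpha'_i,\beta'_i]\subseteq[n]'$ for all $i\in[m]$; it is monotone if it is isomorphic to such a convex graph with additionally $\alpha'_i\le\alpha'_j$ and $\beta'_i\le\beta'_j$ whenever $i<j$ (a "staircase" structure). -}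

module Defs where

open import Data.Nat using (ℕ)
open import Data.Bool using (Bool; true; false)
open import Data.Fin using (Fin; _≤_; _<_)
open import Data.Fin.Permutation using (Permutation′; _⟨$⟩ʳ_)
open import Data.Product using (Σ; ∃; _×_; _,_)
open import Relation.Binary.PropositionalEquality using (_≡_)
open import Relation.Nullary using (¬_)
open import Function.Bundles using (_⇔_)

-- A bipartite graph on [m] ∪ [n]' given by its biadjacency matrix:
-- rows indexed by Fin m, columns by Fin n (in their usual order).
BiAdj : ℕ → ℕ → Set
BiAdj m n = Fin m → Fin n → Bool

NoIsolated : ∀ {m n} → BiAdj m n → Set
NoIsolated {m} {n} A =
  ((i : Fin m) → ∃ λ j → A i j ≡ true) × ((j : Fin n) → ∃ λ i → A i j ≡ true)

Isomorphic : ∀ {m n} → BiAdj m n → BiAdj m n → Set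
Isomorphic {m} {n} A B =
  Σ (Permutation′ m) λ σ → Σ (Permutation′ n) λ τ →
    (i : Fin m) (j : Fin n) → B i j ≡ A (σ ⟨$⟩ʳ i) (τ ⟨$⟩ʳ j)

IntervalRows : ∀ {m n} → BiAdj m n → (α β : Fin m → Fin n) → Set
IntervalRows {m} {n} A α β =
  (i : Fin m) (j : Fin n) → (A i j ≡ true) ⇔ ((α i ≤ j) × (j ≤ β i))

ConvexOrdered : ∀ {m n} → BiAdj m n → Set
ConvexOrdered {m} {n} A =
  Σ (Fin m → Fin n) λ α → Σ (Fin m → Fin n) λ β → IntervalRows A α β

MonotoneOrdered : ∀ {m n} → BiAdj m n → Set
MonotoneOrdered {m} {n} A =
  Σ (Fin m → Fin n) λ α → Σ (Fin m → Fin n) λ β →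
    IntervalRows A α β ×
    ((i j : Fin m) → i < j → (α i ≤ α j) × (β i ≤ β j))

Convex : ∀ {m n} → BiAdj m n → Set
Convex A = ∃ λ B → Isomorphic A B × ConvexOrdered B

Monotone : ∀ {m n} → BiAdj m n → Set
Monotone A = ∃ λ B → Isomorphic A B × MonotoneOrdered B

record Pattern : Set where
  constructor pat
  field
    a b c d : Bool

HasInduced : ∀ {m n} → BiAdj m n → Pattern → Set
HasInduced {m} {n} A (pat a b c d) =
  Σ (Fin m) λ i → Σ (Fin m) λ k → Σ (Fin n) λ j → Σ (Fin n) λ l →
    i < k × j < l ×
    A i j ≡ a × A i l ≡ b × A k j ≡ c × A k l ≡ d

Γ-pat : Pattern
Γ-pat = pat true true true false

backL-pat : Pattern
backL-pat = pat false true true true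

slash-pat : Pattern
slash-pat = pat false true true false

GammaFree : ∀ {m n} → BiAdj m n → Set
GammaFree A =
  ¬ HasInduced A Γ-pat × ¬ HasInduced A backL-pat × ¬ HasInduced A slash-pat

-- A 2×2 submatrix (rows i < k, columns j < l) with ones on its anti-diagonal
-- is forced by the three forbidden patterns to be all ones. Monotone matrices
-- have this closure property directly. Conversely, if it holds, every row is
-- an interval between its first and last one: a gap at column j′ would be
-- filled by closing with any one in column j′ (there is one, as no vertex is
-- isolated); and closing the square spanned by the first (last) ones of two
-- rows shows that these endpoints are nondecreasing.
module Submission where

open import Defs
open import Data.Nat using (ℕ; suc; z≤n; s≤s)
open import Data.Nat.Properties using (<⇒≤)
open import Data.Bool using (Bool; true; false)
open import Data.Bool.Properties using () renaming (_≟_ to _≟ᵇ_)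
open import Data.Fin using (Fin; zero; suc; _≤_; _<_)
open import Data.Fin.Properties
  using (≤-trans; ≤-total; ≤∧≢⇒<; _≟_; <-cmp; any?)
open import Data.Fin.Permutation using (_⟨$⟩ʳ_; _⟨$⟩ˡ_; inverseʳ)
open import Data.Product using (∃; _×_; _,_; proj₁; proj₂)
open import Data.Sum using (inj₁; inj₂)
open import Function.Bundles using (_⇔_; mk⇔; Equivalence)
open import Relation.Binary using (tri<; tri≈; tri>)
open import Relation.Binary.PropositionalEquality using (_≡_; refl; sym; trans; subst)
open import Relation.Nullary using (yes; no; contradiction)

Least : ∀ {n} → (Fin n → Bool) → Fin n → Set
Least f j = f j ≡ true × (∀ k → f k ≡ true → j ≤ k)

Greatest : ∀ {n} → (Fin n → Bool) → Fin n → Set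
Greatest f j = f j ≡ true × (∀ k → f k ≡ true → k ≤ j)

least : ∀ {n} (f : Fin n → Bool) → ∃ (λ j → f j ≡ true) → ∃ (Least f)
least {suc _} f w with f zero in f0
... | true = zero , f0 , λ _ _ → z≤n
least {suc _} f (zero , p) | false = contradiction (trans (sym p) f0) λ ()
least {suc _} f (suc j , p) | false with least (λ k → f (suc k)) (j , p)
... | j′ , q , min = suc j′ , q , λ
  { zero r → contradiction (trans (sym r) f0) λ ()
  ; (suc k) r → s≤s (min k r) }

greatest : ∀ {n} (f : Fin n → Bool) → ∃ (λ j → f j ≡ true) → ∃ (Greatest f)
greatest {suc _} f w with any? (λ k → f (suc k) ≟ᵇ true)
... | yes w′ with greatest (λ k → f (suc k)) w′
...   | j′ , q , max = suc j′ , q , λ { zero _ → z≤n ; (suc k) r → s≤s (max k r) }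
greatest {suc _} f (zero , p) | no ¬w′ = zero , p , λ { zero _ → z≤n ; (suc k) r → contradiction (k , r) ¬w′ }
greatest {suc _} f (suc j , p) | no ¬w′ = contradiction (j , p) ¬w′

-- Columns may coincide (j ≤ l): this lets the closure be applied to the
-- endpoints of two rows without first deciding whether they are equal.
SquareClosed : ∀ {m n} → BiAdj m n → Set
SquareClosed {m} {n} B = ∀ {i k : Fin m} {j l : Fin n} → i < k → j ≤ l →
  B i l ≡ true → B k j ≡ true → B i j ≡ true × B k l ≡ true

SquareClosed⇒GammaFree : ∀ {m n} {B : BiAdj m n} → SquareClosed B → GammaFree B
SquareClosed⇒GammaFree closed =
  (λ (_ , _ , _ , _ , i<k , j<l , _ , bil , bkj , bkl) →
    contradiction (trans (sym (proj₂ (closed i<k (<⇒≤ j<l) bil bkj))) bkl) λ ()) ,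
  (λ (_ , _ , _ , _ , i<k , j<l , bij , bil , bkj , _) →
    contradiction (trans (sym (proj₁ (closed i<k (<⇒≤ j<l) bil bkj))) bij) λ ()) ,
  (λ (_ , _ , _ , _ , i<k , j<l , bij , bil , bkj , _) →
    contradiction (trans (sym (proj₁ (closed i<k (<⇒≤ j<l) bil bkj))) bij) λ ())

GammaFree⇒SquareClosed : ∀ {m n} {B : BiAdj m n} → GammaFree B → SquareClosed B
GammaFree⇒SquareClosed {B = B} (noΓ , noL , noS) {j = j} {l} i<k j≤l bil bkj with j ≟ l
... | yes refl = bil , bkj
... | no j≢l = strict i<k (≤∧≢⇒< j≤l j≢l) bil bkj
  where
  strict : ∀ {i k j l} → i < k → j < l →
    B i l ≡ true → B k j ≡ true → B i j ≡ true × B k l ≡ true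
  strict {i} {k} {j} {l} i<k j<l bil bkj with B i j in bij | B k l in bkl
  ... | true  | true  = refl , refl
  ... | true  | false = contradiction (i , k , j , l , i<k , j<l , bij , bil , bkj , bkl) noΓ
  ... | false | true  = contradiction (i , k , j , l , i<k , j<l , bij , bil , bkj , bkl) noL
  ... | false | false = contradiction (i , k , j , l , i<k , j<l , bij , bil , bkj , bkl) noS

MonotoneOrdered⇒SquareClosed : ∀ {m n} {B : BiAdj m n} → MonotoneOrdered B → SquareClosed B
MonotoneOrdered⇒SquareClosed (α , β , interval , mono) {i} {k} {j} {l} i<k j≤l bil bkj =
  from i j (≤-trans (proj₁ (mono i k i<k)) αk≤j , ≤-trans j≤l l≤βi) ,
  from k l (≤-trans αk≤j j≤l , ≤-trans l≤βi (proj₂ (mono i k i<k)))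
  where
  from = λ i j → Equivalence.from (interval i j)
  αk≤j = proj₁ (Equivalence.to (interval k j) bkj)
  l≤βi = proj₂ (Equivalence.to (interval i l) bil)

module _ {m n} {B : BiAdj m n} (closed : SquareClosed B) where

  row-convex : (∀ j → ∃ λ k → B k j ≡ true) → ∀ {i j j′ l} → j ≤ j′ → j′ ≤ l →
    B i j ≡ true → B i l ≡ true → B i j′ ≡ true
  row-convex column {i} {j′ = j′} j≤j′ j′≤l bij bil with column j′
  ... | k , bkj′ with <-cmp i k
  ...   | tri< i<k _ _ = proj₁ (closed i<k j′≤l bil bkj′)
  ...   | tri≈ _ refl _ = bkj′
  ...   | tri> _ _ k<i = proj₂ (closed k<i j≤j′ bkj′ bij)

  least-mono : ∀ {i k a b} → i < k → Least (B i) a → Least (B k) b → a ≤ b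
  least-mono {a = a} {b} i<k (bia , min) (bkb , _) with ≤-total a b
  ... | inj₁ a≤b = a≤b
  ... | inj₂ b≤a = min b (proj₁ (closed i<k b≤a bia bkb))

  greatest-mono : ∀ {i k a b} → i < k → Greatest (B i) a → Greatest (B k) b → a ≤ b
  greatest-mono {a = a} {b} i<k (bia , _) (bkb , max) with ≤-total a b
  ... | inj₁ a≤b = a≤b
  ... | inj₂ b≤a = max a (proj₂ (closed i<k b≤a bia bkb))

  SquareClosed⇒MonotoneOrdered : NoIsolated B → MonotoneOrdered B
  SquareClosed⇒MonotoneOrdered (row , column) =
    α , β , interval , λ i k i<k →
      least-mono i<k (proj₂ (first i)) (proj₂ (first k)) ,
      greatest-mono i<k (proj₂ (last i)) (proj₂ (last k))
    where
    first = λ i → least (B i) (row i)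
    last = λ i → greatest (B i) (row i)
    α β : Fin m → Fin n
    α i = proj₁ (first i)
    β i = proj₁ (last i)
    interval : IntervalRows B α β
    interval i j = mk⇔
      (λ bij → proj₂ (proj₂ (first i)) j bij , proj₂ (proj₂ (last i)) j bij)
      (λ (α≤j , j≤β) →
        row-convex column α≤j j≤β (proj₁ (proj₂ (first i))) (proj₁ (proj₂ (last i))))

NoIsolated-resp-Isomorphic : ∀ {m n} {A B : BiAdj m n} → Isomorphic A B →
  NoIsolated A → NoIsolated B
NoIsolated-resp-Isomorphic {A = A} (σ , τ , B≡A) (row , column) =
  (λ i → let j , p = row (σ ⟨$⟩ʳ i) in
    τ ⟨$⟩ˡ j , trans (B≡A i (τ ⟨$⟩ˡ j)) (subst (λ j′ → A _ j′ ≡ true) (sym (inverseʳ τ)) p)) ,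
  (λ j → let i , p = column (τ ⟨$⟩ʳ j) in
    σ ⟨$⟩ˡ i , trans (B≡A (σ ⟨$⟩ˡ i) j) (subst (λ i′ → A i′ _ ≡ true) (sym (inverseʳ σ)) p))

lemma8 : (m n : ℕ) (A : BiAdj m n) → NoIsolated A →
    Monotone A ⇔ (∃ λ B → Isomorphic A B × GammaFree B)
lemma8 m n A noIsolated = mk⇔
  (λ (B , A≅B , monotone) →
    B , A≅B , SquareClosed⇒GammaFree (MonotoneOrdered⇒SquareClosed monotone))
  (λ (B , A≅B , gammaFree) →
    B , A≅B , SquareClosed⇒MonotoneOrdered (GammaFree⇒SquareClosed gammaFree)
                (NoIsolated-resp-Isomorphic A≅B noIsolated))
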